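{- Fix integers $t,\ell\ge0$ and let $a^{(i)}_n$ ($n\ge0$, $0\le i\le\ell$) and $b_n$ ($n\ge1$) be weights, and let $M=[M_{n,k}]_{n,k\ge0}$ be the weighted lattice path matrix defined in the context. Then $M_{0,0}=1$, $M_{n,0}=\prod_{i=1}^{n}b_i$ for $n\ge1$, and for all $n\ge0$ and $k\ge1$, $$M_{n,k}=\sum_{j=0}^{\ell}\Big(\sum_{m=0}^{j}a_{n-m}^{(j-m)}\prod_{i=0}^{m-1}b_{n-i}\Big)M_{n-t-j,k-1}+\sum_{j\ge0}\Big(\sum_{m=0}^{\ell}a_{n-j-m-1}^{(\ell-m)}\prod_{i=0}^{j+m}b_{n-i}\Big)M_{n-t-\ell-j-1,k-1},$$ where empty products equal $1$ and $M_{p,q}=0$ whenever $p<0$ or $q<0$ (any term containing such a factor is $0$).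
   Context: For $n,k\ge0$, $M_{n,k}$ is the sum of the weights of all lattice paths in $\mathbb{N}^2$ from $(0,0)$ to $(k,n)$ using the steps $(0,1)$ and $(1,t+i)$ for $0\le i\le\ell$, where each step $(0,1)$ starting at height $n-1$ gets weight $b_n$, each step $(1,t+i)$ starting at height $n-t-i$ gets weight $a^{(i)}_n$, and the weight of a path is the product of the weights of its steps. -}

module Defs where

open import Level using (Level)
open import Algebra.Bundles using (CommutativeRing)
open import Data.Nat using (ℕ; zero; suc; _+_; _∸_; _≤?_; _≟_)
open import Data.Fin using (Fin; toℕ)
open import Data.Fin.Base using () renaming (zero to fz)
open import Data.List using (List; []; _∷_; map; concatMap; allFin; upTo)
open import Data.Product using (_×_; _,_)
open import Relation.Nullary using (yes; no)

-- Steps of the lattice paths: (0,1) and (1,t+i) for 0 ≤ i ≤ ℓ.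
data Step (ℓ : ℕ) : Set where
  up   : Step ℓ
  diag : Fin (suc ℓ) → Step ℓ

allSteps : (ℓ : ℕ) → List (Step ℓ)
allSteps ℓ = up ∷ map diag (allFin (suc ℓ))

stepSeqs : (ℓ : ℕ) → ℕ → List (List (Step ℓ))
stepSeqs ℓ zero    = [] ∷ []
stepSeqs ℓ (suc L) = concatMap (λ s → map (s ∷_) (stepSeqs ℓ L)) (allSteps ℓ)

stepSeqsUpTo : (ℓ : ℕ) → ℕ → List (List (Step ℓ))
stepSeqsUpTo ℓ L = concatMap (stepSeqs ℓ) (upTo (suc L))

endpoint : ∀ {ℓ} (t : ℕ) → ℕ × ℕ → List (Step ℓ) → ℕ × ℕ
endpoint t (x , y) []             = (x , y)
endpoint t (x , y) (up ∷ s)       = endpoint t (x , suc y) s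
endpoint t (x , y) (diag i ∷ s)   = endpoint t (suc x , y + (t + toℕ i)) s

module Paths {c r : Level} (R : CommutativeRing c r) where
  open CommutativeRing R public using (Carrier; 0#; 1#; _≈_)
    renaming (_+_ to _⊕_; _*_ to _⊛_)

  sumR : ℕ → (ℕ → Carrier) → Carrier
  sumR zero    f = 0#
  sumR (suc n) f = sumR n f ⊕ f n

  prodR : ℕ → (ℕ → Carrier) → Carrier
  prodR zero    f = 1#
  prodR (suc n) f = prodR n f ⊛ f n

  sumList : List Carrier → Carrier
  sumList []       = 0#
  sumList (x ∷ xs) = x ⊕ sumList xs

  -- weight of a path starting at height h:
  --   a (0,1) step starting at height h gets b (h+1),
  --   a (1,t+i) step starting at height h gets a i (h+t+i)  (i.e. a^{(i)}_{n} with n its end height).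
  weight : ∀ {ℓ} (t : ℕ) (a : ℕ → ℕ → Carrier) (b : ℕ → Carrier) → ℕ → List (Step ℓ) → Carrier
  weight t a b h []           = 1#
  weight t a b h (up ∷ s)     = b (suc h) ⊛ weight t a b (suc h) s
  weight t a b h (diag i ∷ s) = a (toℕ i) (h + (t + toℕ i)) ⊛ weight t a b (h + (t + toℕ i)) s

  contrib : ∀ {ℓ} (t : ℕ) (a : ℕ → ℕ → Carrier) (b : ℕ → Carrier) → ℕ → ℕ → List (Step ℓ) → Carrier
  contrib t a b n k s with endpoint t (0 , 0) s
  ... | (x , y) with x ≟ k | y ≟ n
  ...   | yes _ | yes _ = weight t a b 0 s
  ...   | _     | _     = 0#

  -- M_{n,k}: sum of weights of all paths from (0,0) to (k,n).
  -- Every step raises x+y by at least 1, so such a path has at most n+k steps;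
  -- we sum over all step sequences of length ≤ n+k.
  M : (t ℓ : ℕ) (a : ℕ → ℕ → Carrier) (b : ℕ → Carrier) → ℕ → ℕ → Carrier
  M t ℓ a b n k = sumList (map (contrib {ℓ} t a b n k) (stepSeqsUpTo ℓ (n + k)))

  Msub : (t ℓ : ℕ) (a : ℕ → ℕ → Carrier) (b : ℕ → Carrier) → ℕ → ℕ → ℕ → Carrier
  Msub t ℓ a b n d k with d ≤? n
  ... | yes _ = M t ℓ a b (n ∸ d) k
  ... | no  _ = 0#

-- Classifying the paths to (k , n) by their last step gives, for (n , k) ≠ (0 , 0),
--   M_{n,k} = b_n M_{n-1,k} + Σ_{i ≤ ℓ} a^{(i)}_n M_{n-t-i,k-1}.
-- In column 0 only up steps occur, so M_{n,0} = b_1 ⋯ b_n.  For k ≥ 1, unrolling the up steps at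
-- the end of a path gives M_{n,k} = Σ_m (b_n ⋯ b_{n-m+1}) Σ_i a^{(i)}_{n-m} M_{n-m-t-i,k-1};
-- grouping these terms by d = m + i separates the antidiagonals d ≤ ℓ from d = ℓ + 1 + j, which
-- are the two sums of the statement.  Terms with n - m - t - i < 0 vanish, so j ≤ n suffices.

module Submission where

open import Defs
open import Level using (Level)
open import Algebra.Bundles using (CommutativeRing)
import Algebra.Properties.CommutativeSemigroup as CommSemigroupProperties
open import Data.Nat using (ℕ; zero; suc; _+_; _∸_; _≤_; _<_; _≤?_; _≟_; z≤n; s≤s)
import Data.Nat.Properties as ℕ
open import Data.Nat.Tactic.RingSolver using (solve-∀)
open import Data.Fin as Fin using (Fin; toℕ)
open import Data.List using (List; []; _∷_; map; _++_; concatMap; allFin; upTo; applyUpTo; tabulate; length)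
open import Data.Product using (_×_; _,_; proj₁; proj₂)
open import Relation.Nullary using (yes; no; ¬_; Dec)
open import Relation.Binary.PropositionalEquality as ≡ using (_≡_; _≢_)
open import Data.Empty using (⊥-elim)
open import Function using (_∘_; id)
import Relation.Binary.Reasoning.Setoid as SetoidReasoning

module Sums {c r : Level} (R : CommutativeRing c r) where
  open CommutativeRing R renaming (_+_ to _⊕_; _*_ to _⊛_)
  open Paths R using (sumR; prodR; sumList)
  open CommSemigroupProperties +-commutativeSemigroup using (interchange)
  open SetoidReasoning setoid

  sumR-cong : ∀ n {f g : ℕ → Carrier} → (∀ i → i < n → f i ≈ g i) → sumR n f ≈ sumR n g
  sumR-cong zero    f≈g = refl
  sumR-cong (suc n) f≈g = +-cong (sumR-cong n (λ i i<n → f≈g i (ℕ.m<n⇒m<1+n i<n))) (f≈g n ℕ.≤-refl)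

  sumR-zero : ∀ n {f : ℕ → Carrier} → (∀ i → i < n → f i ≈ 0#) → sumR n f ≈ 0#
  sumR-zero zero    f≈0 = refl
  sumR-zero (suc n) f≈0 =
    trans (+-cong (sumR-zero n (λ i i<n → f≈0 i (ℕ.m<n⇒m<1+n i<n))) (f≈0 n ℕ.≤-refl)) (+-identityʳ 0#)

  sumR-distrib-+ : ∀ n (f g : ℕ → Carrier) → sumR n (λ i → f i ⊕ g i) ≈ sumR n f ⊕ sumR n g
  sumR-distrib-+ zero    f g = sym (+-identityʳ 0#)
  sumR-distrib-+ (suc n) f g = trans (+-cong (sumR-distrib-+ n f g) refl) (interchange _ _ _ _)

  sumR-*ˡ : ∀ n x (f : ℕ → Carrier) → sumR n (λ i → x ⊛ f i) ≈ x ⊛ sumR n f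
  sumR-*ˡ zero    x f = sym (zeroʳ x)
  sumR-*ˡ (suc n) x f = trans (+-cong (sumR-*ˡ n x f) refl) (sym (distribˡ x _ _))

  sumR-*ʳ : ∀ n x (f : ℕ → Carrier) → sumR n (λ i → f i ⊛ x) ≈ sumR n f ⊛ x
  sumR-*ʳ zero    x f = sym (zeroˡ x)
  sumR-*ʳ (suc n) x f = trans (+-cong (sumR-*ʳ n x f) refl) (sym (distribʳ x _ _))

  sumR-comm : ∀ m n (f : ℕ → ℕ → Carrier) →
              sumR m (λ i → sumR n (f i)) ≈ sumR n (λ j → sumR m (λ i → f i j))
  sumR-comm zero    n f = sym (sumR-zero n (λ _ _ → refl))
  sumR-comm (suc m) n f =
    trans (+-cong (sumR-comm m n f) refl) (sym (sumR-distrib-+ n (λ j → sumR m (λ i → f i j)) (f m)))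

  sumR-suc : ∀ n (f : ℕ → Carrier) → sumR (suc n) f ≈ f 0 ⊕ sumR n (f ∘ suc)
  sumR-suc zero    f = trans (+-identityˡ _) (sym (+-identityʳ _))
  sumR-suc (suc n) f = trans (+-cong (sumR-suc n f) refl) (+-assoc _ _ _)

  prodR-suc : ∀ n (f : ℕ → Carrier) → prodR (suc n) f ≈ f 0 ⊛ prodR n (f ∘ suc)
  prodR-suc zero    f = trans (*-identityˡ _) (sym (*-identityʳ _))
  prodR-suc (suc n) f = trans (*-cong (prodR-suc n f) refl) (*-assoc _ _ _)

  sumR-reverse : ∀ n (f : ℕ → Carrier) → sumR n f ≈ sumR n (λ i → f (n ∸ suc i))
  sumR-reverse zero    f = refl
  sumR-reverse (suc n) f = begin
    sumR n f ⊕ f n                     ≈⟨ +-cong (sumR-reverse n f) refl ⟩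
    sumR n (λ i → f (n ∸ suc i)) ⊕ f n ≈⟨ +-comm _ _ ⟩
    f n ⊕ sumR n (λ i → f (n ∸ suc i)) ≈⟨ sumR-suc n (λ i → f (n ∸ i)) ⟨
    sumR (suc n) (λ i → f (n ∸ i))     ∎

  sumR-+ : ∀ m n (f : ℕ → Carrier) → sumR (m + n) f ≈ sumR n f ⊕ sumR m (λ i → f (n + i))
  sumR-+ zero    n f = sym (+-identityʳ _)
  sumR-+ (suc m) n f = begin
    sumR (m + n) f ⊕ f (m + n)                         ≈⟨ +-cong (sumR-+ m n f) (reflexive (≡.cong f (ℕ.+-comm m n))) ⟩
    (sumR n f ⊕ sumR m (λ i → f (n + i))) ⊕ f (n + m) ≈⟨ +-assoc _ _ _ ⟩
    sumR n f ⊕ (sumR m (λ i → f (n + i)) ⊕ f (n + m)) ∎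

  sumR-tail : ∀ {m n} (f : ℕ → Carrier) → m ≤ n → (∀ i → m ≤ i → f i ≈ 0#) → sumR n f ≈ sumR m f
  sumR-tail {m} {n} f m≤n f≈0 = begin
    sumR n f                                   ≡⟨ ≡.cong (λ n → sumR n f) (ℕ.m∸n+n≡m m≤n) ⟨
    sumR ((n ∸ m) + m) f                       ≈⟨ sumR-+ (n ∸ m) m f ⟩
    sumR m f ⊕ sumR (n ∸ m) (λ i → f (m + i))
      ≈⟨ +-cong refl (sumR-zero (n ∸ m) (λ i _ → f≈0 (m + i) (ℕ.m≤m+n m i))) ⟩
    sumR m f ⊕ 0#                              ≈⟨ +-identityʳ _ ⟩
    sumR m f                                   ∎

  module _ (F : ℕ → ℕ → Carrier) where

    antidiagonal : ℕ → ℕ → Carrier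
    antidiagonal d i with i ≤? d
    ... | yes _ = F (d ∸ i) i
    ... | no  _ = 0#

    antidiagonal-≤ : ∀ {d i} → i ≤ d → antidiagonal d i ≡ F (d ∸ i) i
    antidiagonal-≤ {d} {i} i≤d with i ≤? d
    ... | yes _   = ≡.refl
    ... | no  i≰d = ⊥-elim (i≰d i≤d)

    antidiagonal-≰ : ∀ {d i} → ¬ i ≤ d → antidiagonal d i ≡ 0#
    antidiagonal-≰ {d} {i} i≰d with i ≤? d
    ... | yes i≤d = ⊥-elim (i≰d i≤d)
    ... | no  _   = ≡.refl

    sumR-antidiagonal-column : ∀ N L {i} → i < L → (∀ m → N ≤ m → F m i ≈ 0#) →
                               sumR (N + L) (λ d → antidiagonal d i) ≈ sumR N (λ m → F m i)
    sumR-antidiagonal-column N L {i} i<L F≈0 = begin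
      sumR (N + L) (λ d → antidiagonal d i)
        ≡⟨ ≡.cong (λ n → sumR n (λ d → antidiagonal d i)) (ℕ.m∸n+n≡m i≤N+L) ⟨
      sumR ((N + L ∸ i) + i) (λ d → antidiagonal d i)
        ≈⟨ sumR-+ (N + L ∸ i) i _ ⟩
      sumR i (λ d → antidiagonal d i) ⊕ sumR (N + L ∸ i) (λ e → antidiagonal (i + e) i)
        ≈⟨ +-cong (sumR-zero i (λ d d<i → reflexive (antidiagonal-≰ (ℕ.<⇒≱ d<i))))
                  (sumR-cong (N + L ∸ i) (λ e _ → reflexive (≡.trans (antidiagonal-≤ (ℕ.m≤m+n i e))
                                                                      (≡.cong (λ m → F m i) (ℕ.m+n∸m≡n i e))))) ⟩
      0# ⊕ sumR (N + L ∸ i) (λ m → F m i)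
        ≈⟨ +-identityˡ _ ⟩
      sumR (N + L ∸ i) (λ m → F m i)
        ≈⟨ sumR-tail (λ m → F m i) N≤N+L∸i F≈0 ⟩
      sumR N (λ m → F m i) ∎
      where
      i≤N+L : i ≤ N + L
      i≤N+L = ℕ.≤-trans (ℕ.<⇒≤ i<L) (ℕ.m≤n+m L N)
      N≤N+L∸i : N ≤ N + L ∸ i
      N≤N+L∸i = ℕ.≤-trans (ℕ.≤-reflexive (≡.sym (ℕ.m+n∸n≡m N L))) (ℕ.∸-monoʳ-≤ (N + L) (ℕ.<⇒≤ i<L))

    sumR-antidiagonal-short : ∀ L {d} → d < L → sumR L (antidiagonal d) ≈ sumR (suc d) (λ i → F (d ∸ i) i)
    sumR-antidiagonal-short L {d} d<L = begin
      sumR L (antidiagonal d)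
        ≈⟨ sumR-tail (antidiagonal d) d<L (λ i d<i → reflexive (antidiagonal-≰ (ℕ.<⇒≱ d<i))) ⟩
      sumR (suc d) (antidiagonal d)
        ≈⟨ sumR-cong (suc d) (λ i i≤d → reflexive (antidiagonal-≤ (ℕ.≤-pred i≤d))) ⟩
      sumR (suc d) (λ i → F (d ∸ i) i) ∎

    sumR-antidiagonals : ∀ N L → (∀ m i → N ≤ m → F m i ≈ 0#) →
      sumR N (λ m → sumR L (F m)) ≈
      sumR L (λ d → sumR (suc d) (λ i → F (d ∸ i) i)) ⊕ sumR N (λ j → sumR L (λ i → F (L + j ∸ i) i))
    sumR-antidiagonals N L F≈0 = begin
      sumR N (λ m → sumR L (F m))
        ≈⟨ sumR-comm N L F ⟩
      sumR L (λ i → sumR N (λ m → F m i))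
        ≈⟨ sumR-cong L (λ i i<L → sumR-antidiagonal-column N L i<L (λ m N≤m → F≈0 m i N≤m)) ⟨
      sumR L (λ i → sumR (N + L) (λ d → antidiagonal d i))
        ≈⟨ sumR-comm (N + L) L (λ d i → antidiagonal d i) ⟨
      sumR (N + L) (λ d → sumR L (antidiagonal d))
        ≈⟨ sumR-+ N L _ ⟩
      sumR L (λ d → sumR L (antidiagonal d)) ⊕ sumR N (λ j → sumR L (antidiagonal (L + j)))
        ≈⟨ +-cong (sumR-cong L (λ d → sumR-antidiagonal-short L))
                  (sumR-cong N (λ j _ → sumR-cong L (λ i i<L →
                     reflexive (antidiagonal-≤ (ℕ.≤-trans (ℕ.<⇒≤ i<L) (ℕ.m≤m+n L j)))))) ⟩
      sumR L (λ d → sumR (suc d) (λ i → F (d ∸ i) i)) ⊕ sumR N (λ j → sumR L (λ i → F (L + j ∸ i) i)) ∎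

  sumMap : ∀ {A : Set} → (A → Carrier) → List A → Carrier
  sumMap f xs = sumList (map f xs)

  sumMap-cong : ∀ {A : Set} {f g : A → Carrier} xs → (∀ x → f x ≈ g x) → sumMap f xs ≈ sumMap g xs
  sumMap-cong []       f≈g = refl
  sumMap-cong (x ∷ xs) f≈g = +-cong (f≈g x) (sumMap-cong xs f≈g)

  sumMap-zero : ∀ {A : Set} {f : A → Carrier} xs → (∀ x → f x ≈ 0#) → sumMap f xs ≈ 0#
  sumMap-zero []       f≈0 = refl
  sumMap-zero (x ∷ xs) f≈0 = trans (+-cong (f≈0 x) (sumMap-zero xs f≈0)) (+-identityʳ 0#)

  sumMap-++ : ∀ {A : Set} (f : A → Carrier) xs ys → sumMap f (xs ++ ys) ≈ sumMap f xs ⊕ sumMap f ys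
  sumMap-++ f []       ys = sym (+-identityˡ _)
  sumMap-++ f (x ∷ xs) ys = trans (+-cong refl (sumMap-++ f xs ys)) (sym (+-assoc _ _ _))

  sumMap-concatMap : ∀ {A B : Set} (f : B → Carrier) (g : A → List B) xs →
                     sumMap f (concatMap g xs) ≈ sumMap (λ x → sumMap f (g x)) xs
  sumMap-concatMap f g []       = refl
  sumMap-concatMap f g (x ∷ xs) = trans (sumMap-++ f (g x) (concatMap g xs)) (+-cong refl (sumMap-concatMap f g xs))

  sumMap-map : ∀ {A B : Set} (f : B → Carrier) (g : A → B) xs → sumMap f (map g xs) ≈ sumMap (f ∘ g) xs
  sumMap-map f g []       = refl
  sumMap-map f g (x ∷ xs) = +-cong refl (sumMap-map f g xs)

  sumMap-distrib-+ : ∀ {A : Set} (f g : A → Carrier) xs → sumMap (λ x → f x ⊕ g x) xs ≈ sumMap f xs ⊕ sumMap g xs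
  sumMap-distrib-+ f g []       = sym (+-identityʳ 0#)
  sumMap-distrib-+ f g (x ∷ xs) = trans (+-cong refl (sumMap-distrib-+ f g xs)) (interchange _ _ _ _)

  sumMap-*ˡ : ∀ {A : Set} y (f : A → Carrier) xs → sumMap (λ x → y ⊛ f x) xs ≈ y ⊛ sumMap f xs
  sumMap-*ˡ y f []       = sym (zeroʳ y)
  sumMap-*ˡ y f (x ∷ xs) = trans (+-cong refl (sumMap-*ˡ y f xs)) (sym (distribˡ y _ _))

  sumMap-sumR : ∀ {A : Set} n (f : ℕ → A → Carrier) xs →
                sumMap (λ x → sumR n (λ i → f i x)) xs ≈ sumR n (λ i → sumMap (f i) xs)
  sumMap-sumR zero    f xs = sumMap-zero xs (λ _ → refl)
  sumMap-sumR (suc n) f xs =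
    trans (sumMap-distrib-+ (λ x → sumR n (λ i → f i x)) (f n) xs) (+-cong (sumMap-sumR n f xs) refl)

  sumMap-applyUpTo : ∀ (f : ℕ → Carrier) (g : ℕ → ℕ) n → sumMap f (applyUpTo g n) ≈ sumR n (f ∘ g)
  sumMap-applyUpTo f g zero    = refl
  sumMap-applyUpTo f g (suc n) = trans (+-cong refl (sumMap-applyUpTo f (g ∘ suc) n)) (sym (sumR-suc n (f ∘ g)))

  sumMap-tabulate : ∀ {A : Set} n (g : Fin n → A) (f : A → Carrier) (h : ℕ → Carrier) →
                    (∀ i → f (g i) ≈ h (toℕ i)) → sumMap f (tabulate g) ≈ sumR n h
  sumMap-tabulate zero    g f h eq = refl
  sumMap-tabulate (suc n) g f h eq =
    trans (+-cong (eq Fin.zero) (sumMap-tabulate n (g ∘ Fin.suc) f (h ∘ suc) (eq ∘ Fin.suc))) (sym (sumR-suc n h))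

module LatticePaths {c r : Level} (R : CommutativeRing c r) (t ℓ : ℕ)
                    (a : ℕ → ℕ → CommutativeRing.Carrier R) (b : ℕ → CommutativeRing.Carrier R) where
  open CommutativeRing R renaming (_+_ to _⊕_; _*_ to _⊛_)
  open Paths R using (sumR; prodR; weight; contrib; M; Msub)
  open Sums R
  open SetoidReasoning setoid

  M′ : ℕ → ℕ → Carrier
  M′ = M t ℓ a b

  Msub′ : ℕ → ℕ → ℕ → Carrier
  Msub′ = Msub t ℓ a b

  contrib′ : ℕ → ℕ → List (Step ℓ) → Carrier
  contrib′ = contrib t a b

  sumLength : ℕ → (List (Step ℓ) → Carrier) → Carrier
  sumLength L f = sumMap f (stepSeqs ℓ L)

  sumSteps : (Step ℓ → Carrier) → Carrier
  sumSteps g = sumMap g (allSteps ℓ)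

  sumSteps-split : ∀ g (h : ℕ → Carrier) → (∀ i → g (diag i) ≈ h (toℕ i)) → sumSteps g ≈ g up ⊕ sumR (suc ℓ) h
  sumSteps-split g h eq =
    +-cong refl (trans (sumMap-map g diag (allFin (suc ℓ))) (sumMap-tabulate (suc ℓ) id (g ∘ diag) h eq))

  sumLength-∷ : ∀ L f → sumLength (suc L) f ≈ sumSteps (λ z → sumLength L (λ s → f (z ∷ s)))
  sumLength-∷ L f = trans (sumMap-concatMap f (λ z → map (z ∷_) (stepSeqs ℓ L)) (allSteps ℓ))
                          (sumMap-cong (allSteps ℓ) (λ z → sumMap-map f (z ∷_) (stepSeqs ℓ L)))

  sumLength-snoc : ∀ L f → sumLength (suc L) f ≈ sumLength L (λ s → sumSteps (λ z → f (s ++ z ∷ [])))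
  sumLength-snoc zero f = begin
    sumLength 1 f                        ≈⟨ sumLength-∷ 0 f ⟩
    sumSteps (λ z → f (z ∷ []) ⊕ 0#)     ≈⟨ sumMap-cong (allSteps ℓ) (λ z → +-identityʳ _) ⟩
    sumSteps (λ z → f (z ∷ []))          ≈⟨ +-identityʳ _ ⟨
    sumSteps (λ z → f (z ∷ [])) ⊕ 0#     ∎
  sumLength-snoc (suc L) f = begin
    sumLength (suc (suc L)) f
      ≈⟨ sumLength-∷ (suc L) f ⟩
    sumSteps (λ y → sumLength (suc L) (λ s → f (y ∷ s)))
      ≈⟨ sumMap-cong (allSteps ℓ) (λ y → sumLength-snoc L (λ s → f (y ∷ s))) ⟩
    sumSteps (λ y → sumLength L (λ s → sumSteps (λ z → f (y ∷ s ++ z ∷ []))))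
      ≈⟨ sumLength-∷ L _ ⟨
    sumLength (suc L) (λ s → sumSteps (λ z → f (s ++ z ∷ []))) ∎

  sumLength-zero : ∀ L f → (∀ s → length s ≡ L → f s ≈ 0#) → sumLength L f ≈ 0#
  sumLength-zero zero    f f≈0 = trans (+-identityʳ _) (f≈0 [] ≡.refl)
  sumLength-zero (suc L) f f≈0 = trans (sumLength-∷ L f)
    (sumMap-zero (allSteps ℓ) (λ z → sumLength-zero L _ (λ s |s|≡L → f≈0 (z ∷ s) (≡.cong suc |s|≡L))))

  shorterThan : ℕ → List (List (Step ℓ))
  shorterThan B = concatMap (stepSeqs ℓ) (upTo B)

  -- M′ n k is definitionally sumShorter (suc (n + k)) (contrib′ n k).
  sumShorter : ℕ → (List (Step ℓ) → Carrier) → Carrier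
  sumShorter B f = sumMap f (shorterThan B)

  sumShorter-sumR : ∀ B f → sumShorter B f ≈ sumR B (λ L → sumLength L f)
  sumShorter-sumR B f =
    trans (sumMap-concatMap f (stepSeqs ℓ) (upTo B)) (sumMap-applyUpTo (λ L → sumLength L f) id B)

  sumShorter-snoc : ∀ B f → sumShorter (suc B) f ≈ f [] ⊕ sumShorter B (λ s → sumSteps (λ z → f (s ++ z ∷ [])))
  sumShorter-snoc B f = begin
    sumShorter (suc B) f
      ≈⟨ sumShorter-sumR (suc B) f ⟩
    sumR (suc B) (λ L → sumLength L f)
      ≈⟨ sumR-suc B _ ⟩
    (f [] ⊕ 0#) ⊕ sumR B (λ L → sumLength (suc L) f)
      ≈⟨ +-cong (+-identityʳ _) (sumR-cong B (λ L _ → sumLength-snoc L f)) ⟩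
    f [] ⊕ sumR B (λ L → sumLength L (λ s → sumSteps (λ z → f (s ++ z ∷ []))))
      ≈⟨ +-cong refl (sumShorter-sumR B _) ⟨
    f [] ⊕ sumShorter B (λ s → sumSteps (λ z → f (s ++ z ∷ []))) ∎

  move : ℕ × ℕ → Step ℓ → ℕ × ℕ
  move (x , y) up       = (x , suc y)
  move (x , y) (diag i) = (suc x , y + (t + toℕ i))

  stepWeight : ℕ → Step ℓ → Carrier
  stepWeight h up       = b (suc h)
  stepWeight h (diag i) = a (toℕ i) (h + (t + toℕ i))

  endpoint-snoc : ∀ p s z → endpoint t p (s ++ z ∷ []) ≡ move (endpoint t p s) z
  endpoint-snoc (x , y) []           up       = ≡.refl
  endpoint-snoc (x , y) []           (diag i) = ≡.refl
  endpoint-snoc (x , y) (up ∷ s)     z        = endpoint-snoc (x , suc y) s z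
  endpoint-snoc (x , y) (diag i ∷ s) z        = endpoint-snoc (suc x , y + (t + toℕ i)) s z

  weight-snoc : ∀ x h s z →
                weight t a b h (s ++ z ∷ []) ≈ weight t a b h s ⊛ stepWeight (proj₂ (endpoint t (x , h) s)) z
  weight-snoc x h []           up       = trans (*-identityʳ _) (sym (*-identityˡ _))
  weight-snoc x h []           (diag i) = trans (*-identityʳ _) (sym (*-identityˡ _))
  weight-snoc x h (up ∷ s)     z = trans (*-cong refl (weight-snoc x (suc h) s z)) (sym (*-assoc _ _ _))
  weight-snoc x h (diag i ∷ s) z =
    trans (*-cong refl (weight-snoc (suc x) (h + (t + toℕ i)) s z)) (sym (*-assoc _ _ _))

  length-≤-endpoint : ∀ x y (s : List (Step ℓ)) →
                      x + y + length s ≤ proj₁ (endpoint t (x , y) s) + proj₂ (endpoint t (x , y) s)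
  length-≤-endpoint x y [] = ℕ.≤-reflexive (ℕ.+-identityʳ (x + y))
  length-≤-endpoint x y (up ∷ s) =
    ℕ.≤-trans (ℕ.≤-reflexive (shift x y (length s))) (length-≤-endpoint x (suc y) s)
    where
    shift : ∀ x y l → x + y + suc l ≡ x + suc y + l
    shift = solve-∀
  length-≤-endpoint x y (diag i ∷ s) =
    ℕ.≤-trans (ℕ.≤-trans (ℕ.≤-reflexive (shift x y (length s)))
                         (ℕ.+-monoˡ-≤ (length s) (ℕ.+-monoʳ-≤ (suc x) (ℕ.m≤m+n y (t + toℕ i)))))
              (length-≤-endpoint (suc x) (y + (t + toℕ i)) s)
    where
    shift : ∀ x y l → x + y + suc l ≡ suc x + y + l
    shift = solve-∀

  endpoint₀ : List (Step ℓ) → ℕ × ℕ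
  endpoint₀ = endpoint t (0 , 0)

  weight₀ : List (Step ℓ) → Carrier
  weight₀ = weight t a b 0

  onlyAt : ℕ → ℕ → ℕ × ℕ → Carrier → Carrier
  onlyAt n k (x , y) w with x ≟ k | y ≟ n
  ... | yes _ | yes _ = w
  ... | _     | _     = 0#

  contrib≡onlyAt : ∀ n k s → contrib′ n k s ≡ onlyAt n k (endpoint₀ s) (weight₀ s)
  contrib≡onlyAt n k s with endpoint₀ s
  ... | (x , y) with x ≟ k | y ≟ n
  ...   | yes _ | yes _ = ≡.refl
  ...   | yes _ | no  _ = ≡.refl
  ...   | no  _ | _     = ≡.refl

  onlyAt-at : ∀ n k w → onlyAt n k (k , n) w ≡ w
  onlyAt-at n k w with k ≟ k | n ≟ n
  ... | yes _ | yes _   = ≡.refl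
  ... | no k≢k | _      = ⊥-elim (k≢k ≡.refl)
  ... | yes _ | no n≢n  = ⊥-elim (n≢n ≡.refl)

  onlyAt-offˣ : ∀ n k x y w → x ≢ k → onlyAt n k (x , y) w ≡ 0#
  onlyAt-offˣ n k x y w x≢k with x ≟ k | y ≟ n
  ... | yes x≡k | _ = ⊥-elim (x≢k x≡k)
  ... | no _    | _ = ≡.refl

  onlyAt-offʸ : ∀ n k x y w → y ≢ n → onlyAt n k (x , y) w ≡ 0#
  onlyAt-offʸ n k x y w y≢n with x ≟ k | y ≟ n
  ... | _     | yes y≡n = ⊥-elim (y≢n y≡n)
  ... | yes _ | no _    = ≡.refl
  ... | no _  | no _    = ≡.refl

  onlyAt-cong : ∀ n k p {w w′} → w ≈ w′ → onlyAt n k p w ≈ onlyAt n k p w′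
  onlyAt-cong n k (x , y) w≈w′ with x ≟ k | y ≟ n
  ... | yes _ | yes _ = w≈w′
  ... | yes _ | no  _ = refl
  ... | no  _ | _     = refl

  onlyAt-far : ∀ n k x y w → n + k < x + y → onlyAt n k (x , y) w ≡ 0#
  onlyAt-far n k x y w n+k<x+y with x ≟ k | y ≟ n
  ... | yes ≡.refl | yes ≡.refl = ⊥-elim (ℕ.<-irrefl (ℕ.+-comm n x) n+k<x+y)
  ... | no _       | _          = ≡.refl
  ... | yes _      | no _       = ≡.refl

  private
    0≈*0 : ∀ {u v} x → u ≡ 0# → v ≡ 0# → u ≈ x ⊛ v
    0≈*0 x ≡.refl ≡.refl = sym (zeroʳ x)

  onlyAt-up : ∀ n k x y w → onlyAt (suc n) k (x , suc y) (w ⊛ b (suc y)) ≈ b (suc n) ⊛ onlyAt n k (x , y) w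
  onlyAt-up n k x y w = cases (x ≟ k) (y ≟ n)
    where
    cases : Dec (x ≡ k) → Dec (y ≡ n) →
            onlyAt (suc n) k (x , suc y) (w ⊛ b (suc y)) ≈ b (suc n) ⊛ onlyAt n k (x , y) w
    cases (yes ≡.refl) (yes ≡.refl) = begin
      onlyAt (suc y) x (x , suc y) (w ⊛ b (suc y)) ≡⟨ onlyAt-at (suc y) x _ ⟩
      w ⊛ b (suc y)                                ≈⟨ *-comm _ _ ⟩
      b (suc y) ⊛ w                                ≡⟨ ≡.cong (b (suc y) ⊛_) (onlyAt-at y x w) ⟨
      b (suc y) ⊛ onlyAt y x (x , y) w             ∎
    cases (no x≢k) _        =
      0≈*0 (b (suc n)) (onlyAt-offˣ (suc n) k x (suc y) _ x≢k) (onlyAt-offˣ n k x y w x≢k)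
    cases (yes _)  (no y≢n) =
      0≈*0 (b (suc n)) (onlyAt-offʸ (suc n) k x (suc y) _ (y≢n ∘ ℕ.suc-injective)) (onlyAt-offʸ n k x y w y≢n)

  onlyAt-diag : ∀ {n d} k x y w (g : ℕ → Carrier) → d ≤ n →
                onlyAt n (suc k) (suc x , y + d) (w ⊛ g (y + d)) ≈ g n ⊛ onlyAt (n ∸ d) k (x , y) w
  onlyAt-diag {n} {d} k x y w g d≤n = cases (x ≟ k) (y ≟ n ∸ d)
    where
    cases : Dec (x ≡ k) → Dec (y ≡ n ∸ d) →
            onlyAt n (suc k) (suc x , y + d) (w ⊛ g (y + d)) ≈ g n ⊛ onlyAt (n ∸ d) k (x , y) w
    cases (yes ≡.refl) (yes ≡.refl) rewrite ℕ.m∸n+n≡m d≤n = begin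
      onlyAt n (suc x) (suc x , n) (w ⊛ g n) ≡⟨ onlyAt-at n (suc x) _ ⟩
      w ⊛ g n                                ≈⟨ *-comm _ _ ⟩
      g n ⊛ w                                ≡⟨ ≡.cong (g n ⊛_) (onlyAt-at (n ∸ d) x w) ⟨
      g n ⊛ onlyAt (n ∸ d) x (x , n ∸ d) w   ∎
    cases (no x≢k) _ =
      0≈*0 (g n) (onlyAt-offˣ n (suc k) (suc x) (y + d) _ (x≢k ∘ ℕ.suc-injective)) (onlyAt-offˣ (n ∸ d) k x y w x≢k)
    cases (yes _)  (no y≢n∸d) =
      0≈*0 (g n) (onlyAt-offʸ n (suc k) (suc x) (y + d) _
                    (λ y+d≡n → y≢n∸d (≡.trans (≡.sym (ℕ.m+n∸n≡m y d)) (≡.cong (_∸ d) y+d≡n))))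
                 (onlyAt-offʸ (n ∸ d) k x y w y≢n∸d)

  onlyAt-diag-≰ : ∀ {n d} k x y w → ¬ d ≤ n → onlyAt n k (x , y + d) w ≡ 0#
  onlyAt-diag-≰ {n} {d} k x y w d≰n =
    onlyAt-offʸ n k x (y + d) w (λ y+d≡n → d≰n (≡.subst (d ≤_) y+d≡n (ℕ.m≤n+m d y)))

  contrib-snoc : ∀ n k s z →
    contrib′ n k (s ++ z ∷ []) ≈ onlyAt n k (move (endpoint₀ s) z) (weight₀ s ⊛ stepWeight (proj₂ (endpoint₀ s)) z)
  contrib-snoc n k s z = begin
    contrib′ n k (s ++ z ∷ [])
      ≡⟨ contrib≡onlyAt n k (s ++ z ∷ []) ⟩
    onlyAt n k (endpoint₀ (s ++ z ∷ [])) (weight₀ (s ++ z ∷ []))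
      ≡⟨ ≡.cong (λ p → onlyAt n k p (weight₀ (s ++ z ∷ []))) (endpoint-snoc (0 , 0) s z) ⟩
    onlyAt n k (move (endpoint₀ s) z) (weight₀ (s ++ z ∷ []))
      ≈⟨ onlyAt-cong n k (move (endpoint₀ s) z) (weight-snoc 0 0 s z) ⟩
    onlyAt n k (move (endpoint₀ s) z) (weight₀ s ⊛ stepWeight (proj₂ (endpoint₀ s)) z) ∎

  contrib-snoc-up-zero : ∀ k s → contrib′ 0 k (s ++ up ∷ []) ≈ 0#
  contrib-snoc-up-zero k s =
    trans (contrib-snoc 0 k s up) (reflexive (onlyAt-offʸ 0 k (proj₁ (endpoint₀ s)) _ _ λ ()))

  contrib-snoc-up : ∀ n k s → contrib′ (suc n) k (s ++ up ∷ []) ≈ b (suc n) ⊛ contrib′ n k s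
  contrib-snoc-up n k s = begin
    contrib′ (suc n) k (s ++ up ∷ [])               ≈⟨ contrib-snoc (suc n) k s up ⟩
    onlyAt (suc n) k (move (endpoint₀ s) up) (weight₀ s ⊛ b (suc (proj₂ (endpoint₀ s))))
                                                    ≈⟨ onlyAt-up n k (proj₁ (endpoint₀ s)) (proj₂ (endpoint₀ s)) (weight₀ s) ⟩
    b (suc n) ⊛ onlyAt n k (endpoint₀ s) (weight₀ s) ≡⟨ ≡.cong (b (suc n) ⊛_) (contrib≡onlyAt n k s) ⟨
    b (suc n) ⊛ contrib′ n k s                      ∎

  -- contrib′ n k (s ++ diag i ∷ []) as a function of toℕ i, so that it can be summed with sumR.
  diagExtension : ℕ → ℕ → List (Step ℓ) → ℕ → Carrier
  diagExtension n k s j = onlyAt n k (suc (proj₁ (endpoint₀ s)) , proj₂ (endpoint₀ s) + (t + j))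
                                     (weight₀ s ⊛ a j (proj₂ (endpoint₀ s) + (t + j)))

  diagExtension-≤ : ∀ n k s j → t + j ≤ n → diagExtension n (suc k) s j ≈ a j n ⊛ contrib′ (n ∸ (t + j)) k s
  diagExtension-≤ n k s j t+j≤n =
    trans (onlyAt-diag k (proj₁ (endpoint₀ s)) (proj₂ (endpoint₀ s)) (weight₀ s) (a j) t+j≤n)
          (*-cong refl (reflexive (≡.sym (contrib≡onlyAt (n ∸ (t + j)) k s))))

  diagExtension-≰ : ∀ n k s j → ¬ t + j ≤ n → diagExtension n k s j ≡ 0#
  diagExtension-≰ n k s j t+j≰n = onlyAt-diag-≰ k (suc (proj₁ (endpoint₀ s))) (proj₂ (endpoint₀ s)) _ t+j≰n

  contrib-[] : ∀ n k → 0 < n + k → contrib′ n k [] ≈ 0#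
  contrib-[] (suc n) k     _ = reflexive (≡.trans (contrib≡onlyAt (suc n) k []) (onlyAt-offʸ (suc n) k 0 0 1# λ ()))
  contrib-[] zero (suc k) _ = reflexive (≡.trans (contrib≡onlyAt 0 (suc k) []) (onlyAt-offˣ 0 (suc k) 0 0 1# λ ()))

  contrib-long : ∀ n k s → n + k < length s → contrib′ n k s ≈ 0#
  contrib-long n k s n+k<|s| = reflexive (≡.trans (contrib≡onlyAt n k s)
    (onlyAt-far n k (proj₁ (endpoint₀ s)) (proj₂ (endpoint₀ s)) (weight₀ s)
                (ℕ.<-≤-trans n+k<|s| (length-≤-endpoint 0 0 s))))

  sumShorter-contrib : ∀ B n k → suc (n + k) ≤ B → sumShorter B (contrib′ n k) ≈ M′ n k
  sumShorter-contrib B n k n+k<B = begin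
    sumShorter B (contrib′ n k)
      ≈⟨ sumShorter-sumR B (contrib′ n k) ⟩
    sumR B (λ L → sumLength L (contrib′ n k))
      ≈⟨ sumR-tail _ n+k<B (λ L n+k<L → sumLength-zero L (contrib′ n k)
                                          (λ s |s|≡L → contrib-long n k s (≡.subst (n + k <_) (≡.sym |s|≡L) n+k<L))) ⟩
    sumR (suc (n + k)) (λ L → sumLength L (contrib′ n k))
      ≈⟨ sumShorter-sumR (suc (n + k)) (contrib′ n k) ⟨
    M′ n k ∎

  Msub′-≤ : ∀ {n d} k → d ≤ n → Msub′ n d k ≡ M′ (n ∸ d) k
  Msub′-≤ {n} {d} k d≤n with d ≤? n
  ... | yes _   = ≡.refl
  ... | no  d≰n = ⊥-elim (d≰n d≤n)

  Msub′-≰ : ∀ {n d} k → ¬ d ≤ n → Msub′ n d k ≡ 0#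
  Msub′-≰ {n} {d} k d≰n with d ≤? n
  ... | yes d≤n = ⊥-elim (d≰n d≤n)
  ... | no  _   = ≡.refl

  lastDiagonal : ℕ → ℕ → Carrier
  lastDiagonal n k = sumR (suc ℓ) (λ i → a i n ⊛ Msub′ n (t + i) k)

  M-by-last-step : ∀ n k → 0 < n + k →
    M′ n k ≈ sumShorter (n + k) (λ s → contrib′ n k (s ++ up ∷ []))
             ⊕ sumR (suc ℓ) (λ j → sumShorter (n + k) (λ s → diagExtension n k s j))
  M-by-last-step n k 0<n+k = begin
    M′ n k
      ≈⟨ sumShorter-snoc (n + k) (contrib′ n k) ⟩
    contrib′ n k [] ⊕ sumShorter (n + k) (λ s → sumSteps (λ z → contrib′ n k (s ++ z ∷ [])))
      ≈⟨ +-cong (contrib-[] n k 0<n+k)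
                (sumMap-cong (shorterThan (n + k))
                   (λ s → sumSteps-split _ (diagExtension n k s) (λ i → contrib-snoc n k s (diag i)))) ⟩
    0# ⊕ sumShorter (n + k) (λ s → contrib′ n k (s ++ up ∷ []) ⊕ sumR (suc ℓ) (diagExtension n k s))
      ≈⟨ +-identityˡ _ ⟩
    sumShorter (n + k) (λ s → contrib′ n k (s ++ up ∷ []) ⊕ sumR (suc ℓ) (diagExtension n k s))
      ≈⟨ sumMap-distrib-+ _ _ (shorterThan (n + k)) ⟩
    sumShorter (n + k) (λ s → contrib′ n k (s ++ up ∷ [])) ⊕ sumShorter (n + k) (λ s → sumR (suc ℓ) (diagExtension n k s))
      ≈⟨ +-cong refl (sumMap-sumR (suc ℓ) (λ j s → diagExtension n k s j) (shorterThan (n + k))) ⟩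
    sumShorter (n + k) (λ s → contrib′ n k (s ++ up ∷ []))
      ⊕ sumR (suc ℓ) (λ j → sumShorter (n + k) (λ s → diagExtension n k s j)) ∎

  lastUp-zero : ∀ B k → sumShorter B (λ s → contrib′ 0 k (s ++ up ∷ [])) ≈ 0#
  lastUp-zero B k = sumMap-zero (shorterThan B) (contrib-snoc-up-zero k)

  lastUp-suc : ∀ n k → sumShorter (suc (n + k)) (λ s → contrib′ (suc n) k (s ++ up ∷ [])) ≈ b (suc n) ⊛ M′ n k
  lastUp-suc n k = trans (sumMap-cong (shorterThan (suc (n + k))) (contrib-snoc-up n k))
                         (sumMap-*ˡ (b (suc n)) (contrib′ n k) (shorterThan (suc (n + k))))

  lastDiag-zero : ∀ B n → sumR (suc ℓ) (λ j → sumShorter B (λ s → diagExtension n 0 s j)) ≈ 0#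
  lastDiag-zero B n = sumR-zero (suc ℓ) (λ j _ → sumMap-zero (shorterThan B) (λ s → refl))

  lastDiag-suc : ∀ n k → sumR (suc ℓ) (λ j → sumShorter (n + suc k) (λ s → diagExtension n (suc k) s j)) ≈ lastDiagonal n k
  lastDiag-suc n k = sumR-cong (suc ℓ) (λ j _ → cases j (t + j ≤? n))
    where
    cases : ∀ j → Dec (t + j ≤ n) → sumShorter (n + suc k) (λ s → diagExtension n (suc k) s j) ≈ a j n ⊛ Msub′ n (t + j) k
    cases j (yes t+j≤n) = begin
      sumShorter (n + suc k) (λ s → diagExtension n (suc k) s j)
        ≈⟨ sumMap-cong (shorterThan (n + suc k)) (λ s → diagExtension-≤ n k s j t+j≤n) ⟩
      sumShorter (n + suc k) (λ s → a j n ⊛ contrib′ (n ∸ (t + j)) k s)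
        ≈⟨ sumMap-*ˡ (a j n) _ (shorterThan (n + suc k)) ⟩
      a j n ⊛ sumShorter (n + suc k) (contrib′ (n ∸ (t + j)) k)
        ≈⟨ *-cong refl (sumShorter-contrib (n + suc k) (n ∸ (t + j)) k short) ⟩
      a j n ⊛ M′ (n ∸ (t + j)) k
        ≡⟨ ≡.cong (a j n ⊛_) (Msub′-≤ k t+j≤n) ⟨
      a j n ⊛ Msub′ n (t + j) k ∎
      where
      short : suc (n ∸ (t + j) + k) ≤ n + suc k
      short = ℕ.≤-trans (s≤s (ℕ.+-monoˡ-≤ k (ℕ.m∸n≤m n (t + j)))) (ℕ.≤-reflexive (≡.sym (ℕ.+-suc n k)))
    cases j (no t+j≰n) =
      trans (sumMap-zero (shorterThan (n + suc k)) (λ s → reflexive (diagExtension-≰ n (suc k) s j t+j≰n)))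
            (0≈*0 (a j n) ≡.refl (Msub′-≰ k t+j≰n))

  M-0-0 : M′ 0 0 ≈ 1#
  M-0-0 = +-identityʳ 1#

  M-up : ∀ n → M′ (suc n) 0 ≈ b (suc n) ⊛ M′ n 0
  M-up n = trans (M-by-last-step (suc n) 0 (s≤s z≤n))
                 (trans (+-cong (lastUp-suc n 0) (lastDiag-zero (suc n + 0) (suc n))) (+-identityʳ _))

  M-diag : ∀ k → M′ 0 (suc k) ≈ lastDiagonal 0 k
  M-diag k = trans (M-by-last-step 0 (suc k) (s≤s z≤n))
                   (trans (+-cong (lastUp-zero (suc k) (suc k)) (lastDiag-suc 0 k)) (+-identityˡ _))

  M-up-diag : ∀ n k → M′ (suc n) (suc k) ≈ b (suc n) ⊛ M′ n (suc k) ⊕ lastDiagonal (suc n) k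
  M-up-diag n k = trans (M-by-last-step (suc n) (suc k) (s≤s z≤n))
                        (+-cong (lastUp-suc n (suc k)) (lastDiag-suc (suc n) k))

  M-first-column : ∀ n → M′ (suc n) 0 ≈ prodR (suc n) (λ i → b (suc i))
  M-first-column zero    = trans (M-up 0) (trans (*-cong refl M-0-0) (*-comm _ _))
  M-first-column (suc n) = trans (M-up (suc n)) (trans (*-cong refl (M-first-column n)) (*-comm _ _))

  bProduct : ℕ → ℕ → Carrier
  bProduct n m = prodR m (λ i → b (n ∸ i))

  M-unfold-ups : ∀ n k → M′ n (suc k) ≈ sumR (suc n) (λ m → bProduct n m ⊛ lastDiagonal (n ∸ m) k)
  M-unfold-ups zero    k = trans (M-diag k) (sym (trans (+-identityˡ _) (*-identityˡ _)))
  M-unfold-ups (suc n) k = begin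
    M′ (suc n) (suc k)
      ≈⟨ M-up-diag n k ⟩
    b (suc n) ⊛ M′ n (suc k) ⊕ lastDiagonal (suc n) k
      ≈⟨ +-comm _ _ ⟩
    lastDiagonal (suc n) k ⊕ b (suc n) ⊛ M′ n (suc k)
      ≈⟨ +-cong refl (*-cong refl (M-unfold-ups n k)) ⟩
    lastDiagonal (suc n) k ⊕ b (suc n) ⊛ sumR (suc n) (λ m → bProduct n m ⊛ lastDiagonal (n ∸ m) k)
      ≈⟨ +-cong (*-identityˡ _) (sumR-*ˡ (suc n) (b (suc n)) _) ⟨
    1# ⊛ lastDiagonal (suc n) k ⊕ sumR (suc n) (λ m → b (suc n) ⊛ (bProduct n m ⊛ lastDiagonal (n ∸ m) k))
      ≈⟨ +-cong refl (sumR-cong (suc n) (λ m _ →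
           trans (sym (*-assoc _ _ _)) (*-cong (sym (prodR-suc m (λ i → b (suc n ∸ i)))) refl))) ⟩
    1# ⊛ lastDiagonal (suc n) k ⊕ sumR (suc n) (λ m → bProduct (suc n) (suc m) ⊛ lastDiagonal (n ∸ m) k)
      ≈⟨ sumR-suc (suc n) (λ m → bProduct (suc n) m ⊛ lastDiagonal (suc n ∸ m) k) ⟨
    sumR (suc (suc n)) (λ m → bProduct (suc n) m ⊛ lastDiagonal (suc n ∸ m) k) ∎

  Msub′-shift : ∀ {n m} d k → m ≤ n → Msub′ (n ∸ m) d k ≡ Msub′ n (m + d) k
  Msub′-shift {n} {m} d k m≤n = cases (d ≤? n ∸ m) (m + d ≤? n)
    where
    cases : Dec (d ≤ n ∸ m) → Dec (m + d ≤ n) → Msub′ (n ∸ m) d k ≡ Msub′ n (m + d) k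
    cases (yes d≤n∸m) (yes m+d≤n) =
      ≡.trans (Msub′-≤ k d≤n∸m) (≡.trans (≡.cong (λ p → M′ p k) (ℕ.∸-+-assoc n m d)) (≡.sym (Msub′-≤ k m+d≤n)))
    cases (yes d≤n∸m) (no m+d≰n) =
      ⊥-elim (m+d≰n (ℕ.≤-trans (ℕ.+-monoʳ-≤ m d≤n∸m) (ℕ.≤-reflexive (ℕ.m+[n∸m]≡n m≤n))))
    cases (no d≰n∸m) (yes m+d≤n) =
      ⊥-elim (d≰n∸m (≡.subst (_≤ n ∸ m) (ℕ.m+n∸m≡n m d) (ℕ.∸-monoˡ-≤ m m+d≤n)))
    cases (no d≰n∸m) (no m+d≰n)  = ≡.trans (Msub′-≰ k d≰n∸m) (≡.sym (Msub′-≰ k m+d≰n))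

  module _ (n k : ℕ) where

    -- Paths to (k + 1 , n) whose last diagonal step is (1 , t + i), followed by m up steps.
    viaLastDiagonal : ℕ → ℕ → Carrier
    viaLastDiagonal m i = (a i (n ∸ m) ⊛ bProduct n m) ⊛ Msub′ n (t + (m + i)) k

    viaLastDiagonal-vanishes : ∀ m i → suc n ≤ m → viaLastDiagonal m i ≈ 0#
    viaLastDiagonal-vanishes m i n<m =
      trans (*-cong refl (reflexive (Msub′-≰ k (ℕ.<⇒≱ n<t+[m+i])))) (zeroʳ _)
      where
      n<t+[m+i] : n < t + (m + i)
      n<t+[m+i] = ℕ.≤-trans n<m (ℕ.≤-trans (ℕ.m≤m+n m i) (ℕ.m≤n+m (m + i) t))

    bProduct-lastDiagonal : ∀ {m} → m ≤ n → bProduct n m ⊛ lastDiagonal (n ∸ m) k ≈ sumR (suc ℓ) (viaLastDiagonal m)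
    bProduct-lastDiagonal {m} m≤n = begin
      bProduct n m ⊛ lastDiagonal (n ∸ m) k
        ≈⟨ sumR-*ˡ (suc ℓ) (bProduct n m) _ ⟨
      sumR (suc ℓ) (λ i → bProduct n m ⊛ (a i (n ∸ m) ⊛ Msub′ (n ∸ m) (t + i) k))
        ≈⟨ sumR-cong (suc ℓ) (λ i _ → trans (sym (*-assoc _ _ _))
             (*-cong (*-comm _ _) (reflexive (≡.trans (Msub′-shift (t + i) k m≤n)
                                                       (≡.cong (λ d → Msub′ n d k) (exchange m t i)))))) ⟩
      sumR (suc ℓ) (viaLastDiagonal m) ∎
      where
      exchange : ∀ m t i → m + (t + i) ≡ t + (m + i)
      exchange = solve-∀

    firstRows : ∀ j →
      sumR (suc j) (λ m → a (j ∸ m) (n ∸ m) ⊛ bProduct n m) ⊛ Msub′ n (t + j) k ≈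
      sumR (suc j) (λ i → viaLastDiagonal (j ∸ i) i)
    firstRows j = begin
      sumR (suc j) (λ m → a (j ∸ m) (n ∸ m) ⊛ bProduct n m) ⊛ Msub′ n (t + j) k
        ≈⟨ sumR-*ʳ (suc j) _ _ ⟨
      sumR (suc j) (λ m → (a (j ∸ m) (n ∸ m) ⊛ bProduct n m) ⊛ Msub′ n (t + j) k)
        ≈⟨ sumR-reverse (suc j) _ ⟩
      sumR (suc j) (λ i → (a (j ∸ (j ∸ i)) (n ∸ (j ∸ i)) ⊛ bProduct n (j ∸ i)) ⊛ Msub′ n (t + j) k)
        ≈⟨ sumR-cong (suc j) (λ i i<1+j → reflexive
             (≡.cong₂ (λ u v → (a u (n ∸ (j ∸ i)) ⊛ bProduct n (j ∸ i)) ⊛ Msub′ n (t + v) k)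
                      (ℕ.m∸[m∸n]≡n (ℕ.≤-pred i<1+j)) (≡.sym (ℕ.m∸n+n≡m (ℕ.≤-pred i<1+j))))) ⟩
      sumR (suc j) (λ i → viaLastDiagonal (j ∸ i) i) ∎

    laterRows : ∀ j →
      sumR (suc ℓ) (λ m → a (ℓ ∸ m) (n ∸ (j + m + 1)) ⊛ prodR (suc (j + m)) (λ i → b (n ∸ i)))
        ⊛ Msub′ n (t + ℓ + j + 1) k ≈
      sumR (suc ℓ) (λ i → viaLastDiagonal (suc ℓ + j ∸ i) i)
    laterRows j = begin
      sumR (suc ℓ) (λ m → a (ℓ ∸ m) (n ∸ (j + m + 1)) ⊛ bProduct n (suc (j + m))) ⊛ Msub′ n (t + ℓ + j + 1) k
        ≈⟨ sumR-*ʳ (suc ℓ) _ _ ⟨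
      sumR (suc ℓ) (λ m → (a (ℓ ∸ m) (n ∸ (j + m + 1)) ⊛ bProduct n (suc (j + m))) ⊛ Msub′ n (t + ℓ + j + 1) k)
        ≈⟨ sumR-reverse (suc ℓ) _ ⟩
      sumR (suc ℓ) (λ i → (a (ℓ ∸ (ℓ ∸ i)) (n ∸ (j + (ℓ ∸ i) + 1)) ⊛ bProduct n (suc (j + (ℓ ∸ i))))
                            ⊛ Msub′ n (t + ℓ + j + 1) k)
        ≈⟨ sumR-cong (suc ℓ) (λ i i<1+ℓ → reflexive (reindex (ℕ.≤-pred i<1+ℓ))) ⟩
      sumR (suc ℓ) (λ i → viaLastDiagonal (suc ℓ + j ∸ i) i) ∎
      where
      offset : ∀ {i} → i ≤ ℓ → suc ℓ + j ∸ i ≡ suc (j + (ℓ ∸ i))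
      offset {i} i≤ℓ = ≡.trans (ℕ.+-∸-comm j (ℕ.m≤n⇒m≤1+n i≤ℓ))
                               (≡.trans (≡.cong (_+ j) (ℕ.+-∸-assoc 1 i≤ℓ)) (≡.cong suc (ℕ.+-comm (ℓ ∸ i) j)))
      drop : ∀ t ℓ j → t + ℓ + j + 1 ≡ t + (suc ℓ + j)
      drop = solve-∀
      reindex : ∀ {i} → i ≤ ℓ →
        (a (ℓ ∸ (ℓ ∸ i)) (n ∸ (j + (ℓ ∸ i) + 1)) ⊛ bProduct n (suc (j + (ℓ ∸ i)))) ⊛ Msub′ n (t + ℓ + j + 1) k
          ≡ viaLastDiagonal (suc ℓ + j ∸ i) i
      reindex {i} i≤ℓ =
        ≡.trans (≡.cong₂ (λ u v → (a u (n ∸ v) ⊛ bProduct n (suc (j + (ℓ ∸ i)))) ⊛ Msub′ n (t + ℓ + j + 1) k)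
                         (ℕ.m∸[m∸n]≡n i≤ℓ) (ℕ.+-comm _ 1)) (≡.trans
        (≡.cong (λ v → (a i (n ∸ v) ⊛ bProduct n v) ⊛ Msub′ n (t + ℓ + j + 1) k) (≡.sym (offset i≤ℓ)))
        (≡.cong (λ d → (a i (n ∸ (suc ℓ + j ∸ i)) ⊛ bProduct n (suc ℓ + j ∸ i)) ⊛ Msub′ n d k)
                (≡.trans (drop t ℓ j) (≡.cong (t +_) (≡.sym (ℕ.m∸n+n≡m i≤1+ℓ+j))))))
        where
        i≤1+ℓ+j : i ≤ suc ℓ + j
        i≤1+ℓ+j = ℕ.≤-trans (ℕ.m≤n⇒m≤1+n i≤ℓ) (ℕ.m≤m+n (suc ℓ) j)

  M-recurrence : ∀ n k → M′ n (suc k) ≈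
    sumR (suc ℓ) (λ j →
       sumR (suc j) (λ m → a (j ∸ m) (n ∸ m) ⊛ prodR m (λ i → b (n ∸ i)))
       ⊛ Msub′ n (t + j) k)
    ⊕ sumR (suc n) (λ j →
       sumR (suc ℓ) (λ m → a (ℓ ∸ m) (n ∸ (j + m + 1)) ⊛ prodR (suc (j + m)) (λ i → b (n ∸ i)))
       ⊛ Msub′ n (t + ℓ + j + 1) k)
  M-recurrence n k = begin
    M′ n (suc k)
      ≈⟨ M-unfold-ups n k ⟩
    sumR (suc n) (λ m → bProduct n m ⊛ lastDiagonal (n ∸ m) k)
      ≈⟨ sumR-cong (suc n) (λ m m<1+n → bProduct-lastDiagonal n k (ℕ.≤-pred m<1+n)) ⟩
    sumR (suc n) (λ m → sumR (suc ℓ) (viaLastDiagonal n k m))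
      ≈⟨ sumR-antidiagonals (viaLastDiagonal n k) (suc n) (suc ℓ) (viaLastDiagonal-vanishes n k) ⟩
    sumR (suc ℓ) (λ j → sumR (suc j) (λ i → viaLastDiagonal n k (j ∸ i) i))
      ⊕ sumR (suc n) (λ j → sumR (suc ℓ) (λ i → viaLastDiagonal n k (suc ℓ + j ∸ i) i))
      ≈⟨ +-cong (sumR-cong (suc ℓ) (λ j _ → firstRows n k j)) (sumR-cong (suc n) (λ j _ → laterRows n k j)) ⟨
    _ ∎

proposition2p2 : ∀ {c r : Level} (R : CommutativeRing c r) (t ℓ : ℕ)
  (a : ℕ → ℕ → CommutativeRing.Carrier R) (b : ℕ → CommutativeRing.Carrier R) →
  let open Paths R
  in (M t ℓ a b 0 0 ≈ 1#)
     × (∀ n → M t ℓ a b (suc n) 0 ≈ prodR (suc n) (λ i → b (suc i)))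
     × (∀ n k → M t ℓ a b n (suc k) ≈
          sumR (suc ℓ) (λ j →
             sumR (suc j) (λ m → a (j ∸ m) (n ∸ m) ⊛ prodR m (λ i → b (n ∸ i)))
             ⊛ Msub t ℓ a b n (t + j) k)
          ⊕ sumR (suc n) (λ j →
             sumR (suc ℓ) (λ m → a (ℓ ∸ m) (n ∸ (j + m + 1)) ⊛ prodR (suc (j + m)) (λ i → b (n ∸ i)))
             ⊛ Msub t ℓ a b n (t + ℓ + j + 1) k))
proposition2p2 R t ℓ a b = M-0-0 , M-first-column , M-recurrence
  where open LatticePaths R t ℓ a b
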